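{- Let $f:\mathbb{N}\to\mathbb{N}$ be a multiplicative function such that $f(p^{k-1})\le f(p^k)$ for every prime $p$ and integer $k\ge1$. Let $n$ be $f$-practical, let $p$ be a prime with $\gcd(p,n)=1$, and let $k\ge1$. Then $np^k$ is $f$-practical if and only if $f(p^i)\le S_f(np^{i-1})+1$ for all $1\le i\le k$.
   Context: $\mathbb{N}$ denotes the positive integers. $S_f(n)=\sum_{d\mid n} f(d)$. A positive integer $n$ is $f$-practical if every positive integer $m\le S_f(n)$ can be written as $m=\sum_{d\in\mathcal{D}} f(d)$ for some set $\mathcal{D}$ of divisors of $n$. -}

module Defs where

open import Data.Nat using (ℕ; zero; suc; _+_; _*_; _≤_; _^_)
open import Data.Nat.Divisibility using (_∣_; _∣?_)
open import Data.Nat.Coprimality using (Coprime)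
open import Data.List using (List; map; filter; upTo)
open import Data.Nat.ListAction using (sum)
open import Data.List.Relation.Binary.Sublist.Propositional using (_⊆_)
open import Data.Product using (Σ; _×_)
open import Relation.Binary.PropositionalEquality using (_≡_)

divisors : ℕ → List ℕ
divisors n = filter (_∣? n) (map suc (upTo n))

S : (ℕ → ℕ) → ℕ → ℕ
S f n = sum (map f (divisors n))

Multiplicative : (ℕ → ℕ) → Set
Multiplicative f =
  (f 1 ≡ 1) ×
  (∀ a b → 1 ≤ a → 1 ≤ b → Coprime a b → f (a * b) ≡ f a * f b)

-- Since 'divisors n' has no repetitions, sets of divisors
-- correspond exactly to sublists of 'divisors n'.
FPractical : (ℕ → ℕ) → ℕ → Set
FPractical f n =
  ∀ m → 1 ≤ m → m ≤ S f n →
    Σ (List ℕ) (λ D → (D ⊆ divisors n) × (sum (map f D) ≡ m))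

-- The divisors of n p^(j+1) are those of n p^j together with the e p^(j+1), e ∣ n,
-- so S_f(n p^(j+1)) = S_f(n p^j) + f(p^(j+1)) S_f(n).  If f(p^(j+1)) ≤ S_f(n p^j) + 1,
-- every m ≤ S_f(n p^(j+1)) can be written m = r + f(p^(j+1)) q with r ≤ S_f(n p^j) and
-- q ≤ S_f(n); representing r by divisors of n p^j and q by divisors e of n, then
-- multiplying the latter by p^(j+1), represents m; induction on j gives sufficiency.
-- Conversely, if f(p^i) > S_f(n p^(i-1)) + 1 then m = S_f(n p^(i-1)) + 1 is not
-- representable: by monotonicity every divisor of n p^k not dividing n p^(i-1) has
-- weight at least f(p^i) > m, so a representation of m could only use divisors of
-- n p^(i-1), whose weights add up to less than m.

module Submission where

open import Data.List using (List; []; _∷_; _++_; map; filter; upTo)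
open import Data.List.Properties using (map-++)
open import Data.List.Membership.Propositional using (_∈_)
open import Data.List.Membership.Propositional.Properties
  using (∈-filter⁺; ∈-filter⁻; ∈-map⁺; ∈-map⁻; ∈-++⁺ˡ; ∈-++⁺ʳ; ∈-++⁻; ∈-upTo⁺)
open import Data.List.Membership.Propositional.Properties.WithK using (unique∧set⇒bag)
open import Data.List.Relation.Binary.BagAndSetEquality using (∼bag⇒↭)
open import Data.List.Relation.Binary.Permutation.Propositional using (_↭_)
import Data.List.Relation.Binary.Permutation.Propositional.Properties as ↭
open import Data.List.Relation.Binary.Sublist.Propositional
  using (_⊆_; []; _∷_; _∷ʳ_; lookup; minimum; from∈)
import Data.List.Relation.Binary.Sublist.Propositional.Properties as ⊆
open import Data.List.Relation.Unary.AllPairs using ([]; _∷_)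
open import Data.List.Relation.Unary.Any using (here; there)
open import Data.List.Relation.Unary.Unique.Propositional using (Unique)
import Data.List.Relation.Unary.Unique.Propositional.Properties as Unique
open import Data.Nat
  using (ℕ; zero; suc; _+_; _*_; _∸_; _^_; _≤_; _<_; _≤′_; ≤′-refl; ≤′-step; z≤n; s≤s; s≤s⁻¹;
         NonZero; ≢-nonZero; ≢-nonZero⁻¹; >-nonZero; nonTrivial⇒≢1)
open import Data.Nat.Properties
open import Data.List.Membership.DecPropositional _≟_ using (_∈?_)
open import Data.Nat.DivMod using (_/_; _%_; m≡m%n+[m/n]*n; m%n<n; m/n*n≤m)
open import Data.Nat.Divisibility
open import Data.Nat.Coprimality using (Coprime; coprime-divisor)
open import Data.Nat.Primality using (Prime; prime⇒irreducible; prime⇒nonZero; prime⇒nonTrivial)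
open import Data.Nat.ListAction using (sum)
open import Data.Nat.ListAction.Properties using (sum-++; sum-↭)
open import Data.Nat.Solver using (module +-*-Solver)
open import Data.Product using (Σ; ∃; ∃₂; _×_; _,_; proj₂)
open import Data.Sum using (_⊎_; inj₁; inj₂)
open import Function using (_∘_)
open import Function.Bundles using (_⇔_; mk⇔; Equivalence)
open import Relation.Binary.PropositionalEquality
  using (_≡_; refl; sym; trans; cong; cong₂; subst; module ≡-Reasoning)
open import Relation.Nullary using (¬_; yes; no; contradiction)

open import Defs

open +-*-Solver using (solve; _:*_; _:=_)
open ≡-Reasoning

Unique-resp-⊆ : ∀ {xs ys : List ℕ} → xs ⊆ ys → Unique ys → Unique xs
Unique-resp-⊆ []         []         = []
Unique-resp-⊆ (_ ∷ʳ τ)   (_ ∷ u)    = Unique-resp-⊆ τ u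
Unique-resp-⊆ (refl ∷ τ) (x∉ys ∷ u) = ⊆.All-resp-⊆ τ x∉ys ∷ Unique-resp-⊆ τ u

unique-⊆-set⇒↭-sublist : ∀ {xs ys : List ℕ} → Unique xs → Unique ys →
  (∀ {x} → x ∈ xs → x ∈ ys) → ∃ λ zs → zs ⊆ ys × xs ↭ zs
unique-⊆-set⇒↭-sublist {xs} {ys} xs! ys! xs⊆ys =
  filter (_∈? xs) ys , ⊆.filter-⊆ (_∈? xs) ys ,
  ∼bag⇒↭ (unique∧set⇒bag xs! (Unique.filter⁺ (_∈? xs) ys!) (mk⇔ to from))
  where
  to : ∀ {x} → x ∈ xs → x ∈ filter (_∈? xs) ys
  to x∈xs = ∈-filter⁺ (_∈? xs) (xs⊆ys x∈xs) x∈xs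
  from : ∀ {x} → x ∈ filter (_∈? xs) ys → x ∈ xs
  from x∈zs = proj₂ (∈-filter⁻ (_∈? xs) {xs = ys} x∈zs)

module _ (f : ℕ → ℕ) where

  sum-map-++ : ∀ xs ys → sum (map f (xs ++ ys)) ≡ sum (map f xs) + sum (map f ys)
  sum-map-++ xs ys = trans (cong sum (map-++ f xs ys)) (sum-++ (map f xs) (map f ys))

  sum-map-↭ : ∀ {xs ys} → xs ↭ ys → sum (map f xs) ≡ sum (map f ys)
  sum-map-↭ xs↭ys = sum-↭ (↭.map⁺ f xs↭ys)

  sum-map-mono-⊆ : ∀ {xs ys} → xs ⊆ ys → sum (map f xs) ≤ sum (map f ys)
  sum-map-mono-⊆ []         = ≤-refl
  sum-map-mono-⊆ (y ∷ʳ τ)   = ≤-trans (sum-map-mono-⊆ τ) (m≤n+m _ (f y))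
  sum-map-mono-⊆ (refl ∷ τ) = +-monoʳ-≤ _ (sum-map-mono-⊆ τ)

  ∈⇒≤sum-map : ∀ {x xs} → x ∈ xs → f x ≤ sum (map f xs)
  ∈⇒≤sum-map {x} x∈xs = ≤-trans (m≤m+n (f x) 0) (sum-map-mono-⊆ (from∈ x∈xs))

  sum-map-mono-⊆-set : ∀ {xs ys} → Unique xs → Unique ys →
    (∀ {x} → x ∈ xs → x ∈ ys) → sum (map f xs) ≤ sum (map f ys)
  sum-map-mono-⊆-set xs! ys! xs⊆ys with unique-⊆-set⇒↭-sublist xs! ys! xs⊆ys
  ... | zs , zs⊆ys , xs↭zs = ≤-trans (≤-reflexive (sum-map-↭ xs↭zs)) (sum-map-mono-⊆ zs⊆ys)

  sum-map-scale : ∀ q xs → (∀ {x} → x ∈ xs → f (x * q) ≡ f x * f q) →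
    sum (map f (map (_* q) xs)) ≡ f q * sum (map f xs)
  sum-map-scale q []       _    = sym (*-zeroʳ (f q))
  sum-map-scale q (x ∷ xs) mult = begin
    f (x * q) + sum (map f (map (_* q) xs))
      ≡⟨ cong₂ _+_ (mult (here refl)) (sum-map-scale q xs (mult ∘ there)) ⟩
    f x * f q + f q * sum (map f xs)
      ≡⟨ cong (_+ f q * sum (map f xs)) (*-comm (f x) (f q)) ⟩
    f q * f x + f q * sum (map f xs)
      ≡⟨ *-distribˡ-+ (f q) (f x) (sum (map f xs)) ⟨
    f q * (f x + sum (map f xs))
      ∎

  Representable : List ℕ → ℕ → Set
  Representable ys m = Σ (List ℕ) λ xs → xs ⊆ ys × sum (map f xs) ≡ m

  AllRepresentable : List ℕ → ℕ → Set
  AllRepresentable ys s = ∀ m → m ≤ s → Representable ys m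

  representable-++ : ∀ {xs ys a b} → Representable xs a → Representable ys b →
    Representable (xs ++ ys) (a + b)
  representable-++ (D , D⊆ , refl) (E , E⊆ , refl) = D ++ E , ⊆.++⁺ D⊆ E⊆ , sum-map-++ D E

  representable-scale : ∀ {ys m} q → (∀ {y} → y ∈ ys → f (y * q) ≡ f y * f q) →
    Representable ys m → Representable (map (_* q) ys) (f q * m)
  representable-scale q mult (D , D⊆ , refl) =
    map (_* q) D , ⊆.map⁺ (_* q) D⊆ , sum-map-scale q D (mult ∘ lookup D⊆)

  representable-transfer : ∀ {xs ys m} → Unique xs → Unique ys →
    (∀ {x} → x ∈ xs → x ∈ ys) → Representable xs m → Representable ys m
  representable-transfer xs! ys! xs⊆ys (D , D⊆ , refl)
    with unique-⊆-set⇒↭-sublist (Unique-resp-⊆ D⊆ xs!) ys! (xs⊆ys ∘ lookup D⊆)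
  ... | E , E⊆ys , D↭E = E , E⊆ys , sym (sum-map-↭ D↭E)

  fPractical⇒allRepresentable : ∀ n → FPractical f n → AllRepresentable (divisors n) (S f n)
  fPractical⇒allRepresentable _ _  zero    _ = [] , minimum _ , refl
  fPractical⇒allRepresentable _ fp (suc m)   = fp (suc m) (s≤s z≤n)

bounded-division : ∀ {a T s m} .{{_ : NonZero a}} → a ≤ T + 1 → m ≤ T + a * s →
  ∃₂ λ r q → r ≤ T × q ≤ s × m ≡ r + a * q
bounded-division {a} {T} {s} {m} a≤T+1 m≤T+as with m / a ≤? s
... | yes m/a≤s = m % a , m / a , m%a≤T , m/a≤s ,
  trans (m≡m%n+[m/n]*n m a) (cong (m % a +_) (*-comm (m / a) a))
  where
  m%a≤T : m % a ≤ T
  m%a≤T = s≤s⁻¹ (≤-trans (m%n<n m a) (≤-trans a≤T+1 (≤-reflexive (+-comm T 1))))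
... | no m/a≰s = m ∸ a * s , s , m∸as≤T , ≤-refl , sym (m∸n+n≡m as≤m)
  where
  as≤m : a * s ≤ m
  as≤m = ≤-trans (*-monoʳ-≤ a (<⇒≤ (≰⇒> m/a≰s)))
                 (≤-trans (≤-reflexive (*-comm a (m / a))) (m/n*n≤m m a))
  m∸as≤T : m ∸ a * s ≤ T
  m∸as≤T = m≤n+o⇒m∸n≤o m (a * s) (≤-trans m≤T+as (≤-reflexive (+-comm T (a * s))))

suc-mono⇒mono : (g : ℕ → ℕ) → (∀ k → g k ≤ g (suc k)) → ∀ {a b} → a ≤ b → g a ≤ g b
suc-mono⇒mono g step a≤b = go (≤⇒≤′ a≤b)
  where
  go : ∀ {a b} → a ≤′ b → g a ≤ g b
  go ≤′-refl        = ≤-refl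
  go (≤′-step a≤′b) = ≤-trans (go a≤′b) (step _)

∣⇒1≤ : ∀ {d n} → 1 ≤ n → d ∣ n → 1 ≤ d
∣⇒1≤ {zero}  1≤n 0∣n = subst (1 ≤_) (0∣⇒≡0 0∣n) 1≤n
∣⇒1≤ {suc d} _   _   = s≤s z≤n

∈-divisors⁺ : ∀ {d n} → 1 ≤ n → d ∣ n → d ∈ divisors n
∈-divisors⁺ {zero}  {n}     1≤n 0∣n = contradiction (0∣⇒≡0 0∣n) (≢-nonZero⁻¹ n {{>-nonZero 1≤n}})
∈-divisors⁺ {suc d} {suc n} _   d∣n =
  ∈-filter⁺ (_∣? suc n) (∈-map⁺ suc (∈-upTo⁺ (∣⇒≤ d∣n))) d∣n

∈-divisors⁻ : ∀ {d} n → d ∈ divisors n → d ∣ n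
∈-divisors⁻ n d∈ = proj₂ (∈-filter⁻ (_∣? n) {xs = map suc (upTo n)} d∈)

divisors-unique : ∀ n → Unique (divisors n)
divisors-unique n = Unique.filter⁺ (_∣? n) (Unique.map⁺ suc-injective (Unique.upTo⁺ n))

prime∤⇒coprime : ∀ {p c} → Prime p → ¬ p ∣ c → Coprime c p
prime∤⇒coprime pp p∤c (d∣c , d∣p) with prime⇒irreducible pp d∣p
... | inj₁ d≡1 = d≡1
... | inj₂ refl = contradiction d∣c p∤c

coprime-^ʳ : ∀ {m p} j → Coprime m p → Coprime m (p ^ j)
coprime-^ʳ zero    _   (_ , d∣1) = ∣1⇒≡1 d∣1
coprime-^ʳ {m} {p} (suc j) m⊥p {d} (d∣m , d∣p*p^j) =
  coprime-^ʳ j m⊥p (d∣m , coprime-divisor d⊥p d∣p*p^j)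
  where
  d⊥p : Coprime d p
  d⊥p (c∣d , c∣p) = m⊥p (∣-trans c∣d d∣m , c∣p)

^-monoʳ-∣ : ∀ p {i k} → i ≤ k → p ^ i ∣ p ^ k
^-monoʳ-∣ p {i} {k} i≤k = subst (p ^ i ∣_) p^i*p^[k∸i]≡p^k (m∣m*n (p ^ (k ∸ i)))
  where
  p^i*p^[k∸i]≡p^k : p ^ i * p ^ (k ∸ i) ≡ p ^ k
  p^i*p^[k∸i]≡p^k = trans (sym (^-distribˡ-+-* p i (k ∸ i))) (cong (p ^_) (m+[n∸m]≡n i≤k))

-- With x c = n p^(j+1): if p ∣ c then x ∣ n p^j; otherwise c is coprime to p^(j+1),
-- so c ∣ n and x = (n / c) p^(j+1).
∣n*p^suc⇒∣n*p^⊎≡*p^suc : ∀ {n p x} j → Prime p → x ∣ n * p ^ suc j →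
  x ∣ n * p ^ j ⊎ ∃ λ e → e ∣ n × x ≡ e * p ^ suc j
∣n*p^suc⇒∣n*p^⊎≡*p^suc {n} {p} {x} j pp (divides c n*P≡c*x) with p ∣? c
... | yes (divides c′ c≡c′*p) =
  inj₁ (divides c′ (*-cancelˡ-≡ (n * p ^ j) (c′ * x) p {{prime⇒nonZero pp}} (begin
    p * (n * p ^ j)  ≡⟨ solve 3 (λ p n q → p :* (n :* q) := n :* (p :* q)) refl p n (p ^ j) ⟩
    n * p ^ suc j    ≡⟨ n*P≡c*x ⟩
    c * x            ≡⟨ cong (_* x) c≡c′*p ⟩
    c′ * p * x       ≡⟨ solve 3 (λ c p x → c :* p :* x := p :* (c :* x)) refl c′ p x ⟩
    p * (c′ * x)     ∎)))
... | no p∤c = inj₂ (quotient c∣n , quotient-∣ c∣n , *-cancelˡ-≡ x _ c {{c≢0}} (begin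
    c * x                   ≡⟨ n*P≡c*x ⟨
    n * P                   ≡⟨ cong (_* P) (_∣_.equality c∣n) ⟩
    quotient c∣n * c * P    ≡⟨ solve 3 (λ e c q → e :* c :* q := c :* (e :* q)) refl (quotient c∣n) c P ⟩
    c * (quotient c∣n * P)  ∎))
  where
  P = p ^ suc j
  c≢0 : NonZero c
  c≢0 = ≢-nonZero λ { refl → p∤c (p ∣0) }
  c∣n : c ∣ n
  c∣n = coprime-divisor (coprime-^ʳ (suc j) (prime∤⇒coprime pp p∤c))
          (divides x (trans (*-comm P n) (trans n*P≡c*x (*-comm c x))))

p^suc∤n*p^ : ∀ {n p} j → Prime p → Coprime p n → ¬ p ^ suc j ∣ n * p ^ j
p^suc∤n*p^ {n} {p} j pp p⊥n p*p^j∣n*p^j =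
  nonTrivial⇒≢1 {{prime⇒nonTrivial pp}} (p⊥n (∣-refl , p∣n))
  where
  p∣n : p ∣ n
  p∣n = *-cancelʳ-∣ (p ^ j) {{m^n≢0 p j {{prime⇒nonZero pp}}}} p*p^j∣n*p^j

module _ {n p : ℕ} (1≤n : 1 ≤ n) (pp : Prime p) (p⊥n : Coprime p n) where

  private
    instance
      p≢0 : NonZero p
      p≢0 = prime⇒nonZero pp

    1≤n*p^ : ∀ j → 1 ≤ n * p ^ j
    1≤n*p^ j = *-mono-≤ 1≤n (m^n>0 p j)

  ∈-divisors-n*p^suc : ∀ j {x} → x ∈ divisors (n * p ^ suc j) ⇔
    x ∈ divisors (n * p ^ j) ++ map (_* p ^ suc j) (divisors n)
  ∈-divisors-n*p^suc j {x} = mk⇔ to from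
    where
    to : x ∈ divisors (n * p ^ suc j) → x ∈ divisors (n * p ^ j) ++ map (_* p ^ suc j) (divisors n)
    to x∈ with ∣n*p^suc⇒∣n*p^⊎≡*p^suc {n} j pp (∈-divisors⁻ (n * p ^ suc j) x∈)
    ... | inj₁ x∣ = ∈-++⁺ˡ (∈-divisors⁺ (1≤n*p^ j) x∣)
    ... | inj₂ (e , e∣n , refl) = ∈-++⁺ʳ _ (∈-map⁺ (_* p ^ suc j) (∈-divisors⁺ 1≤n e∣n))
    from : x ∈ divisors (n * p ^ j) ++ map (_* p ^ suc j) (divisors n) → x ∈ divisors (n * p ^ suc j)
    from x∈ with ∈-++⁻ (divisors (n * p ^ j)) x∈
    ... | inj₁ x∈old = ∈-divisors⁺ (1≤n*p^ (suc j))
                         (∣-trans (∈-divisors⁻ (n * p ^ j) x∈old) (*-monoʳ-∣ n (n∣m*n p)))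
    ... | inj₂ x∈new with ∈-map⁻ (_* p ^ suc j) x∈new
    ...   | e , e∈ , refl =
      ∈-divisors⁺ (1≤n*p^ (suc j)) (*-monoˡ-∣ (p ^ suc j) (∈-divisors⁻ n e∈))

  divisors-n*p^++-unique : ∀ j → Unique (divisors (n * p ^ j) ++ map (_* p ^ suc j) (divisors n))
  divisors-n*p^++-unique j =
    Unique.++⁺ (divisors-unique (n * p ^ j))
      (Unique.map⁺ (*-cancelʳ-≡ _ _ (p ^ suc j) {{m^n≢0 p (suc j)}}) (divisors-unique n))
      disjoint
    where
    disjoint : ∀ {v} → ¬ (v ∈ divisors (n * p ^ j) × v ∈ map (_* p ^ suc j) (divisors n))
    disjoint (v∈old , v∈new) with ∈-map⁻ (_* p ^ suc j) v∈new
    ... | e , _ , refl = p^suc∤n*p^ j pp p⊥n (m*n∣⇒n∣ e (p ^ suc j) (∈-divisors⁻ (n * p ^ j) v∈old))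

  divisors-n*p^suc-↭ : ∀ j →
    divisors (n * p ^ suc j) ↭ divisors (n * p ^ j) ++ map (_* p ^ suc j) (divisors n)
  divisors-n*p^suc-↭ j =
    ∼bag⇒↭ (unique∧set⇒bag (divisors-unique (n * p ^ suc j)) (divisors-n*p^++-unique j)
                           (∈-divisors-n*p^suc j))

  module _ {f : ℕ → ℕ} (mult : Multiplicative f) where

    multiplicative-*p^ : ∀ {e} j → e ∣ n → f (e * p ^ j) ≡ f e * f (p ^ j)
    multiplicative-*p^ {e} j e∣n =
      proj₂ mult e (p ^ j) (∣⇒1≤ 1≤n e∣n) (m^n>0 p j) (coprime-^ʳ j e⊥p)
      where
      e⊥p : Coprime e p
      e⊥p (c∣e , c∣p) = p⊥n (c∣p , ∣-trans c∣e e∣n)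

    S-n*p^suc : ∀ j → S f (n * p ^ suc j) ≡ S f (n * p ^ j) + f (p ^ suc j) * S f n
    S-n*p^suc j = begin
      S f (n * p ^ suc j)
        ≡⟨ sum-map-↭ f (divisors-n*p^suc-↭ j) ⟩
      sum (map f (divisors (n * p ^ j) ++ map (_* p ^ suc j) (divisors n)))
        ≡⟨ sum-map-++ f (divisors (n * p ^ j)) _ ⟩
      S f (n * p ^ j) + sum (map f (map (_* p ^ suc j) (divisors n)))
        ≡⟨ cong (S f (n * p ^ j) +_)
             (sum-map-scale f (p ^ suc j) (divisors n) (multiplicative-*p^ (suc j) ∘ ∈-divisors⁻ n)) ⟩
      S f (n * p ^ j) + f (p ^ suc j) * S f n
        ∎

    allRepresentable-n*p^suc : ∀ j → 1 ≤ f (p ^ suc j) → f (p ^ suc j) ≤ S f (n * p ^ j) + 1 →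
      AllRepresentable f (divisors n) (S f n) →
      AllRepresentable f (divisors (n * p ^ j)) (S f (n * p ^ j)) →
      AllRepresentable f (divisors (n * p ^ suc j)) (S f (n * p ^ suc j))
    allRepresentable-n*p^suc j 1≤a a≤T+1 all-n all-n*p^j m m≤
      with bounded-division {{>-nonZero 1≤a}} a≤T+1 (subst (m ≤_) (S-n*p^suc j) m≤)
    ... | r , q , r≤T , q≤s , refl =
      representable-transfer f (divisors-n*p^++-unique j) (divisors-unique (n * p ^ suc j))
        (Equivalence.from (∈-divisors-n*p^suc j))
        (representable-++ f (all-n*p^j r r≤T)
          (representable-scale f (p ^ suc j) (multiplicative-*p^ (suc j) ∘ ∈-divisors⁻ n) (all-n q q≤s)))

    allRepresentable-n*p^ : (∀ d → 1 ≤ d → 1 ≤ f d) → FPractical f n →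
      ∀ {k} → (∀ j → suc j ≤ k → f (p ^ suc j) ≤ S f (n * p ^ j) + 1) →
      ∀ j → j ≤ k → AllRepresentable f (divisors (n * p ^ j)) (S f (n * p ^ j))
    allRepresentable-n*p^ f≥1 fp-n bound zero _ =
      subst (λ N → AllRepresentable f (divisors N) (S f N)) (sym (*-identityʳ n))
        (fPractical⇒allRepresentable f n fp-n)
    allRepresentable-n*p^ f≥1 fp-n bound (suc j) j<k =
      allRepresentable-n*p^suc j (f≥1 _ (m^n>0 p (suc j))) (bound j j<k)
        (fPractical⇒allRepresentable f n fp-n) (allRepresentable-n*p^ f≥1 fp-n bound j (<⇒≤ j<k))

    module _ (f≥1 : ∀ d → 1 ≤ d → 1 ≤ f d) (f-p^-step : ∀ k → f (p ^ k) ≤ f (p ^ suc k)) where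

      ∤n*p^⇒f-p^suc≤ : ∀ {i k x} → i ≤ k → x ∣ n * p ^ k → ¬ x ∣ n * p ^ i → f (p ^ suc i) ≤ f x
      ∤n*p^⇒f-p^suc≤ i≤k = go (≤⇒≤′ i≤k)
        where
        go : ∀ {i k x} → i ≤′ k → x ∣ n * p ^ k → ¬ x ∣ n * p ^ i → f (p ^ suc i) ≤ f x
        go ≤′-refl x∣ x∤ = contradiction x∣ x∤
        go {i} {suc k} (≤′-step i≤′k) x∣ x∤ with ∣n*p^suc⇒∣n*p^⊎≡*p^suc {n} k pp x∣
        ... | inj₁ x∣n*p^k = go i≤′k x∣n*p^k x∤
        ... | inj₂ (e , e∣n , refl) =
          ≤-trans (suc-mono⇒mono (f ∘ (p ^_)) f-p^-step (s≤s (≤′⇒≤ i≤′k)))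
            (≤-trans (m≤n*m (f (p ^ suc k)) (f e) {{>-nonZero (f≥1 e (∣⇒1≤ 1≤n e∣n))}})
              (≤-reflexive (sym (multiplicative-*p^ (suc k) e∣n))))

      fPractical-n*p^⇒bound : ∀ {i k} → FPractical f (n * p ^ k) → suc i ≤ k →
        f (p ^ suc i) ≤ S f (n * p ^ i) + 1
      fPractical-n*p^⇒bound {i} {k} fp i<k = ≮⇒≥ T+1≮a
        where
        T = S f (n * p ^ i)
        a≤S : f (p ^ suc i) ≤ S f (n * p ^ k)
        a≤S = ∈⇒≤sum-map f (∈-divisors⁺ (1≤n*p^ k) (∣n⇒∣m*n n (^-monoʳ-∣ p i<k)))
        T+1≮a : ¬ T + 1 < f (p ^ suc i)
        T+1≮a T+1<a with fp (T + 1) (m≤n+m 1 T) (<⇒≤ (<-≤-trans T+1<a a≤S))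
        ... | D , D⊆ , ΣD≡T+1 =
          m+1+n≰m T (subst (_≤ T) ΣD≡T+1
            (sum-map-mono-⊆-set f (Unique-resp-⊆ D⊆ (divisors-unique (n * p ^ k)))
                                  (divisors-unique (n * p ^ i)) D⊆divisors))
          where
          D⊆divisors : ∀ {x} → x ∈ D → x ∈ divisors (n * p ^ i)
          D⊆divisors {x} x∈D with x ∣? n * p ^ i
          ... | yes x∣ = ∈-divisors⁺ (1≤n*p^ i) x∣
          ... | no x∤ = contradiction
            (≤-trans (∤n*p^⇒f-p^suc≤ (<⇒≤ i<k) (∈-divisors⁻ (n * p ^ k) (lookup D⊆ x∈D)) x∤)
                     (≤-trans (∈⇒≤sum-map f x∈D) (≤-reflexive ΣD≡T+1)))
            (<⇒≱ T+1<a)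

theorem2p5 : (f : ℕ → ℕ) →
    (∀ d → 1 ≤ d → 1 ≤ f d) →
    Multiplicative f →
    (∀ p k → Prime p → 1 ≤ k → f (p ^ (k ∸ 1)) ≤ f (p ^ k)) →
    (n : ℕ) → 1 ≤ n → FPractical f n →
    (p : ℕ) → Prime p → Coprime p n →
    (k : ℕ) → 1 ≤ k →
    FPractical f (n * p ^ k) ⇔
      (∀ i → 1 ≤ i → i ≤ k → f (p ^ i) ≤ S f (n * p ^ (i ∸ 1)) + 1)
theorem2p5 f f≥1 mult mono n 1≤n fp-n p pp p⊥n k _ = mk⇔ necessary sufficient
  where
  f-p^-step : ∀ j → f (p ^ j) ≤ f (p ^ suc j)
  f-p^-step j = mono p (suc j) pp (s≤s z≤n)

  necessary : FPractical f (n * p ^ k) → ∀ i → 1 ≤ i → i ≤ k → f (p ^ i) ≤ S f (n * p ^ (i ∸ 1)) + 1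
  necessary fp (suc i) _ i<k = fPractical-n*p^⇒bound 1≤n pp p⊥n mult f≥1 f-p^-step fp i<k

  sufficient : (∀ i → 1 ≤ i → i ≤ k → f (p ^ i) ≤ S f (n * p ^ (i ∸ 1)) + 1) → FPractical f (n * p ^ k)
  sufficient bound m _ =
    allRepresentable-n*p^ 1≤n pp p⊥n mult f≥1 fp-n (λ j → bound (suc j) (s≤s z≤n)) k ≤-refl m
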